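{- Let $\sigma(P,x)$ be a specification whose inputs $x$ range over a finite domain $X$, over a decidable background theory, and suppose some program $P$ satisfies $\forall x \in X . \sigma(P,x)$. Then the counterexample-guided refinement algorithm described below, with candidates generated by explicit enumeration of programs in order of increasing length, terminates and returns a program $P$ satisfying $\forall x\in X.\sigma(P,x)$.
   Context: The counterexample-guided refinement algorithm maintains a finite set $\mathrm{inputs} \subseteq X$, initially empty, and loops: (SYNTH) find a program $P$ with $\bigwedge_{i \in \mathrm{inputs}} \sigma(i, P)$, here by enumerating all programs in order of increasing length and taking the first one meeting this condition (returning UNSAT if none exists); (VERIF) decide $\exists x . \lnot \sigma(x, P)$ for the candidate $P$; if unsatisfiable, return $P$; otherwise add the satisfying $x$ (a counterexample) to $\mathrm{inputs}$ and repeat. Programs are finite, loop-free, non-recursive lists of instructions in SSA form, each instruction an opcode with operands that are constants, inputs, or results of earlier instructions. -}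

module Defs where

open import Data.Nat using (ℕ; zero; suc)
open import Data.Fin using (Fin)
open import Data.Vec using (Vec)
open import Data.List using (List; []; _∷_; concatMap; upTo)
open import Data.List.Membership.Propositional using (_∈_)
open import Data.List.Relation.Unary.All using (all?)
open import Data.Maybe using (Maybe; just; nothing)
open import Data.Product using (Σ; ∃; _,_)
open import Data.Sum using (_⊎_; inj₁; inj₂)
open import Relation.Nullary using (Dec; yes; no; ¬_)
open import Relation.Binary.PropositionalEquality using (_≡_)

module Syntax (Op : Set) (arity : Op → ℕ) (C : Set) (nIn : ℕ) where

  -- an operand of an instruction that has n earlier instructions
  data Operand (n : ℕ) : Set where
    const  : C → Operand n
    input  : Fin nIn → Operand n
    result : Fin n → Operand n

  record Instr (n : ℕ) : Set where
    constructor instr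
    field
      opcode   : Op
      operands : Vec (Operand n) (arity opcode)

  data Code : ℕ → Set where
    []  : Code 0
    _▷_ : ∀ {n} → Code n → Instr n → Code (suc n)

  Program : Set
  Program = Σ ℕ Code

  len : Program → ℕ
  len (n , _) = n

  record Enumeration : Set where
    field
      progs    : ℕ → List Program
      sound    : ∀ L P → P ∈ progs L → len P ≡ L
      complete : ∀ P → P ∈ progs (len P)

-- The CEGIS loop (with fuel, to make termination explicit).

module CEGIS {Prog X : Set}
  (σ : Prog → X → Set)
  (σ? : ∀ P x → Dec (σ P x))
  (progs : ℕ → List Prog)
  (verif : (P : Prog) → (∀ x → σ P x) ⊎ (∃ λ x → ¬ σ P x))
  where

  firstSat : List X → List Prog → Maybe Prog
  firstSat inputs []       = nothing
  firstSat inputs (P ∷ Ps) with all? (σ? P) inputs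
  ... | yes _ = just P
  ... | no  _ = firstSat inputs Ps

  synth : ℕ → List X → Maybe Prog
  synth f inputs = firstSat inputs (concatMap progs (upTo (suc f)))

  -- run the loop with fuel f; nothing = fuel exhausted (no answer yet)
  cegis : ℕ → List X → Maybe Prog
  cegis zero    inputs = nothing
  cegis (suc f) inputs with synth f inputs
  ... | nothing = nothing
  ... | just P with verif P
  ...   | inj₁ _       = just P
  ...   | inj₂ (x , _) = cegis f (x ∷ inputs)

-- A counterexample returned by VERIF violates the candidate, which satisfies every
-- input collected so far, so it is new: the collected inputs stay duplicate-free and
-- hence number at most |X|.  The program P* that solves the specification satisfies
-- every finite set of inputs, so SYNTH never fails once its length bound reaches
-- len P*.  Each round therefore either returns a verified program or grows the inputs,
-- and after at most |X| failed rounds the loop must return.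

module Submission where

open import Defs
open import Data.Nat using (ℕ; zero; suc; _+_; _≤_; s≤s)
open import Data.Nat.Properties using (≤-trans; ≤-refl; ≮⇒≥; n≮n; m≤m+n; m≤n+m; +-suc)
open import Data.Fin using (Fin)
open import Data.Fin.Properties using (pigeonhole)
import Data.Fin as Fin
open import Data.List using (List; []; _∷_; length; lookup; concatMap; upTo)
open import Data.List.Relation.Unary.All as All using (All; all?)
open import Data.List.Relation.Unary.All.Properties using (¬Any⇒All¬)
open import Data.List.Relation.Unary.Any using (here; there)
open import Data.List.Relation.Unary.AllPairs using ([]; _∷_)
open import Data.List.Relation.Unary.Unique.Propositional using (Unique)
open import Data.List.Membership.Propositional using (_∈_; _∉_; lose)
open import Data.List.Membership.Propositional.Properties using (∈-lookup; ∈-concatMap⁺; ∈-upTo⁺)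
open import Data.Maybe using (just; nothing)
open import Data.Product using (∃; _×_; _,_)
open import Data.Sum using (_⊎_; inj₁; inj₂)
open import Data.Empty using (⊥-elim)
open import Relation.Nullary using (Dec; yes; no; ¬_)
open import Relation.Binary.PropositionalEquality using (_≡_; _≢_; refl; sym; trans; subst)

Unique-lookup-injective : ∀ {A : Set} {xs : List A} → Unique xs →
  ∀ {i j} → i Fin.< j → lookup xs i ≢ lookup xs j
Unique-lookup-injective (x∉ ∷ _) {Fin.zero} {Fin.suc j} _ = All.lookup x∉ (∈-lookup j)
Unique-lookup-injective (_ ∷ u) {Fin.suc i} {Fin.suc j} (s≤s i<j) =
  Unique-lookup-injective u i<j

Unique⇒length≤ : ∀ {k} {xs : List (Fin k)} → Unique xs → length xs ≤ k
Unique⇒length≤ {xs = xs} u = ≮⇒≥ λ k<length →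
  let _ , _ , i<j , eq = pigeonhole k<length (lookup xs)
  in Unique-lookup-injective u i<j eq

module _ {Prog X : Set}
  (σ : Prog → X → Set)
  (σ? : ∀ P x → Dec (σ P x))
  (progs : ℕ → List Prog)
  (verif : (P : Prog) → (∀ x → σ P x) ⊎ (∃ λ x → ¬ σ P x))
  where
  open CEGIS σ σ? progs verif

  Solves : Prog → Set
  Solves P = ∀ x → σ P x

  CegisSucceeds : ℕ → List X → Set
  CegisSucceeds fuel inputs = ∃ λ P → cegis fuel inputs ≡ just P × Solves P

  firstSat-sound : ∀ inputs Ps {P} → firstSat inputs Ps ≡ just P → All (σ P) inputs
  firstSat-sound inputs (Q ∷ Ps) eq with all? (σ? Q) inputs
  firstSat-sound inputs (Q ∷ Ps) refl | yes Q-sat = Q-sat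
  ... | no _ = firstSat-sound inputs Ps eq

  firstSat-complete : ∀ inputs {Ps P} → P ∈ Ps → All (σ P) inputs →
    firstSat inputs Ps ≢ nothing
  firstSat-complete inputs {Q ∷ Ps} P∈ P-sat eq with all? (σ? Q) inputs
  firstSat-complete inputs {Q ∷ Ps} P∈ P-sat () | yes _
  firstSat-complete inputs {Q ∷ Ps} (here refl) P-sat eq | no Q-unsat = Q-unsat P-sat
  firstSat-complete inputs {Q ∷ Ps} (there P∈) P-sat eq | no _ =
    firstSat-complete inputs P∈ P-sat eq

  synth-sound : ∀ f inputs {P} → synth f inputs ≡ just P → All (σ P) inputs
  synth-sound f inputs = firstSat-sound inputs (concatMap progs (upTo (suc f)))

  synth-complete : ∀ {L f inputs P} → P ∈ progs L → L ≤ f → All (σ P) inputs →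
    synth f inputs ≢ nothing
  synth-complete {inputs = inputs} P∈ L≤f =
    firstSat-complete inputs (∈-concatMap⁺ progs (lose (∈-upTo⁺ (s≤s L≤f)) P∈))

  counterexample-fresh : ∀ {P x inputs} → All (σ P) inputs → ¬ σ P x → x ∉ inputs
  counterexample-fresh P-sat ¬σPx x∈ = ¬σPx (All.lookup P-sat x∈)

  module Termination
    (k : ℕ) (Unique⇒length≤k : ∀ {xs : List X} → Unique xs → length xs ≤ k)
    {P* : Prog} {L : ℕ} (P*∈ : P* ∈ progs L) (P*-solves : Solves P*)
    where

    cegis-round : ∀ f inputs → L ≤ f → Unique inputs →
      CegisSucceeds (suc f) inputs
      ⊎ ∃ λ x → Unique (x ∷ inputs) × cegis (suc f) inputs ≡ cegis f (x ∷ inputs)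
    cegis-round f inputs L≤f u with synth f inputs in synth≡
    ... | nothing =
      ⊥-elim (synth-complete P*∈ L≤f (All.tabulate (λ {x} _ → P*-solves x)) synth≡)
    ... | just P with verif P
    ...   | inj₁ P-solves = inj₁ (P , refl , P-solves)
    ...   | inj₂ (x , ¬σPx) =
      inj₂ (x , x∉inputs ∷ u , refl)
      where
      x∉inputs : All (x ≢_) inputs
      x∉inputs = ¬Any⇒All¬ inputs (counterexample-fresh (synth-sound f inputs synth≡) ¬σPx)

    -- n bounds the counterexamples still to come; the fuel covers n failed rounds
    -- beyond the L needed for SYNTH to reach P*.
    cegis-terminates : ∀ n f inputs → Unique inputs →
      k ≤ n + length inputs → n + L ≤ f → CegisSucceeds (suc f) inputs
    cegis-terminates n f inputs u k≤ n+L≤f with cegis-round f inputs (≤-trans (m≤n+m L n) n+L≤f) u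
    ... | inj₁ success = success
    ... | inj₂ (x , u′ , step) =
      let P , cegis≡ , P-solves = next n f k≤ n+L≤f in P , trans step cegis≡ , P-solves
      where
      next : ∀ n f → k ≤ n + length inputs → n + L ≤ f → CegisSucceeds f (x ∷ inputs)
      next zero    f       k≤ _ = ⊥-elim (n≮n (length inputs) (≤-trans (Unique⇒length≤k u′) k≤))
      next (suc n) (suc f) k≤ (s≤s n+L≤f) =
        cegis-terminates n f (x ∷ inputs) u′ (subst (k ≤_) (sym (+-suc n (length inputs))) k≤) n+L≤f

mainTheorem8 : (Op : Set) (arity : Op → ℕ) (C : Set) (nIn : ℕ)
    → (E : Syntax.Enumeration Op arity C nIn)
    → (k : ℕ)
    → (σ : Syntax.Program Op arity C nIn → Fin k → Set)
    → (σ? : ∀ P x → Dec (σ P x))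
    → (verif : (P : Syntax.Program Op arity C nIn) → (∀ x → σ P x) ⊎ (∃ λ x → ¬ σ P x))
    → (∃ λ P → ∀ x → σ P x)
    → ∃ λ fuel → ∃ λ P →
    (CEGIS.cegis σ σ? (Syntax.Enumeration.progs E) verif fuel [] ≡ just P)
    × (∀ x → σ P x)
mainTheorem8 Op arity C nIn E k σ σ? verif (P* , P*-solves) =
  suc (k + L) , cegis-terminates k (k + L) [] [] (m≤m+n k 0) ≤-refl
  where
  open Syntax Op arity C nIn using (len; module Enumeration)
  open Enumeration E using (progs; complete)
  L = len P*
  open Termination σ σ? progs verif k Unique⇒length≤ (complete P*) P*-solves
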